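{- Let $A$ be a linear order and let $X\subseteq A^{\omega}$ be a suborder. Let $fl: A\times A^{\omega}\to A^{\omega}$ be the map $fl(a,(a_0,a_1,\ldots))=(a,a_0,a_1,\ldots)$, and let $AX=\{(a,u):a\in A,\ u\in X\}\subseteq A\times A^\omega$. Then $fl[AX]=X$ if and only if $X$ is a union of tail-equivalence classes of $A^\omega$.
   Context: $A^{\omega}$ is the set of infinite sequences $(a_0,a_1,\ldots)$ of elements of $A$, ordered lexicographically. For a finite sequence $r$ and a (finite or infinite) sequence $u$, $ru$ denotes concatenation. Two sequences $u,v\in A^{\omega}$ are tail-equivalent ($u\sim v$) if there exist finite sequences $r,s$ of elements of $A$ (possibly of different lengths, possibly empty) and $u'\in A^{\omega}$ with $u=ru'$ and $v=su'$; this is an equivalence relation. -}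

module Defs where

open import Level using (Level; _⊔_)
open import Data.Nat using (ℕ; zero; suc)
open import Data.List using (List; []; _∷_)
open import Data.Product using (Σ; ∃; _×_)
open import Relation.Unary using (Pred)
open import Relation.Binary.PropositionalEquality using (_≗_)

Seq : ∀ {a} → Set a → Set a
Seq A = ℕ → A

fl : ∀ {a} {A : Set a} → A → Seq A → Seq A
fl x u zero    = x
fl x u (suc n) = u n

_⊕_ : ∀ {a} {A : Set a} → List A → Seq A → Seq A
[]      ⊕ u = u
(x ∷ r) ⊕ u = fl x (r ⊕ u)

infixr 5 _⊕_

_∼_ : ∀ {a} {A : Set a} → Seq A → Seq A → Set a
_∼_ {A = A} u v =
  Σ (List A) λ r → Σ (List A) λ s → Σ (Seq A) λ u' →
    (u ≗ r ⊕ u') × (v ≗ s ⊕ u')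

-- X ⊆ A^ω is a subset of the setoid (A^ω, pointwise equality)
RespectsSeqEq : ∀ {a p} {A : Set a} → Pred (Seq A) p → Set (a ⊔ p)
RespectsSeqEq X = ∀ {u v} → u ≗ v → X u → X v

flImage : ∀ {a p} {A : Set a} → Pred (Seq A) p → Pred (Seq A) (a ⊔ p)
flImage {A = A} X v = Σ A λ x → Σ (Seq A) λ u → X u × (fl x u ≗ v)

UnionOfTailClasses : ∀ {a p} {A : Set a} → Pred (Seq A) p → Set (a ⊔ p)
UnionOfTailClasses X = ∀ {u v} → u ∼ v → X u → X v

-- The inclusion fl[AX] ⊆ X says that X is closed under prepending a letter, and
-- X ⊆ fl[AX] says that it is closed under deleting the first letter. Tail
-- equivalence u = r u' ∼ s u' = v is generated by exactly these two moves:
-- delete r letter by letter, then prepend s.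
module Submission where

open import Defs
open import Level using (_⊔_)
open import Relation.Unary using (Pred)
open import Relation.Binary.Core using (Rel)
open import Relation.Binary.Structures using (IsStrictTotalOrder)
open import Relation.Binary.PropositionalEquality using (_≡_; refl; sym; _≗_)
open import Function.Bundles using (_⇔_; mk⇔; Equivalence)
open import Data.Nat using (zero; suc)
open import Data.List using ([]; _∷_)
open import Data.Product using (_,_)

tail : ∀ {a} {A : Set a} → Seq A → Seq A
tail v n = v (suc n)

fl-head-tail : ∀ {a} {A : Set a} (v : Seq A) → v ≗ fl (v zero) (tail v)
fl-head-tail v zero    = refl
fl-head-tail v (suc n) = refl

∼-fl : ∀ {a} {A : Set a} (x : A) (u : Seq A) → u ∼ fl x u
∼-fl x u = [] , x ∷ [] , u , (λ _ → refl) , (λ _ → refl)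

∼-tail : ∀ {a} {A : Set a} (v : Seq A) → v ∼ tail v
∼-tail v = v zero ∷ [] , [] , tail v , fl-head-tail v , (λ _ → refl)

FlImageInvariant : ∀ {a p} {A : Set a} → Pred (Seq A) p → Set (a ⊔ p)
FlImageInvariant X = ∀ v → flImage X v ⇔ X v

module FlImageInvariantProperties {a p} {A : Set a} {X : Pred (Seq A) p}
  (resp : RespectsSeqEq X) (inv : FlImageInvariant X) where

  fl⁻¹-closed : ∀ x w → X (fl x w) → X w
  fl⁻¹-closed x w Xxw with Equivalence.from (inv (fl x w)) Xxw
  ... | _ , u , Xu , fl-y-u≗fl-x-w = resp (λ n → fl-y-u≗fl-x-w (suc n)) Xu

  fl-closed : ∀ x w → X w → X (fl x w)
  fl-closed x w Xw = Equivalence.to (inv (fl x w)) (x , w , Xw , λ _ → refl)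

  ⊕⁻¹-closed : ∀ r w → X (r ⊕ w) → X w
  ⊕⁻¹-closed []      w Xw   = Xw
  ⊕⁻¹-closed (x ∷ r) w Xxrw = ⊕⁻¹-closed r w (fl⁻¹-closed x (r ⊕ w) Xxrw)

  ⊕-closed : ∀ r w → X w → X (r ⊕ w)
  ⊕-closed []      w Xw = Xw
  ⊕-closed (x ∷ r) w Xw = fl-closed x (r ⊕ w) (⊕-closed r w Xw)

  unionOfTailClasses : UnionOfTailClasses X
  unionOfTailClasses (r , s , u' , u≗ru' , v≗su') Xu =
    resp (λ n → sym (v≗su' n)) (⊕-closed s u' (⊕⁻¹-closed r u' (resp u≗ru' Xu)))

unionOfTailClasses⇒flImageInvariant : ∀ {a p} {A : Set a} {X : Pred (Seq A) p}
  → RespectsSeqEq X → UnionOfTailClasses X → FlImageInvariant X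
unionOfTailClasses⇒flImageInvariant {X = X} resp closed v = mk⇔ image⊆X X⊆image
  where
  image⊆X : flImage X v → X v
  image⊆X (x , u , Xu , fl-x-u≗v) = resp fl-x-u≗v (closed (∼-fl x u) Xu)

  X⊆image : X v → flImage X v
  X⊆image Xv = v zero , tail v , closed (∼-tail v) Xv , λ n → sym (fl-head-tail v n)

proposition3p4 : ∀ {a ℓ p} {A : Set a} {_<_ : Rel A ℓ}
    → IsStrictTotalOrder _≡_ _<_
    → (X : Pred (Seq A) p)
    → RespectsSeqEq X
    → (∀ v → flImage X v ⇔ X v) ⇔ UnionOfTailClasses X
proposition3p4 _ X resp = mk⇔
  (FlImageInvariantProperties.unionOfTailClasses resp)
  (unionOfTailClasses⇒flImageInvariant resp)
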